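{- Let $\gamma,\gamma'$ be positive integers. There exists an operad morphism $\varphi:\mathbf{CAs}^{(\gamma')}\to\mathbf{CAs}^{(\gamma)}$ if and only if $\mathrm{LComb}_{\gamma'}\equiv_\gamma\mathrm{RComb}_{\gamma'}$.
   Context: A binary tree is either the leaf or an ordered pair of binary trees. $\mathbf{Mag}$ is the nonsymmetric set-theoretic operad of binary trees ($\mathbf{Mag}(n)$ = trees with $n$ leaves), with $\mathfrak{t}\circ_i\mathfrak{s}$ grafting the root of $\mathfrak{s}$ onto the $i$-th leaf of $\mathfrak{t}$. Combs: $\mathrm{LComb}_1=\mathrm{RComb}_1=(\text{leaf},\text{leaf})$, $\mathrm{LComb}_d=(\mathrm{LComb}_{d-1},\text{leaf})$, $\mathrm{RComb}_d=(\text{leaf},\mathrm{RComb}_{d-1})$. For $\gamma\ge1$, $\equiv_\gamma$ is the smallest operad congruence on $\mathbf{Mag}$ with $\mathrm{LComb}_\gamma\equiv_\gamma\mathrm{RComb}_\gamma$, and $\mathbf{CAs}^{(\gamma)}:=\mathbf{Mag}/_{\equiv_\gamma}$. An operad morphism is an arity-preserving map sending unit to unit and commuting with partial compositions. -}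

module Defs where

open import Data.Nat using (ℕ; zero; suc; _+_)
open import Data.Fin using (Fin; splitAt; cast)
open import Data.Sum using (_⊎_; inj₁; inj₂)
open import Data.Product using (Σ; _×_)
open import Relation.Binary.PropositionalEquality using (_≡_; sym)

data Tree : Set where
  leaf : Tree
  node : Tree → Tree → Tree

leaves : Tree → ℕ
leaves leaf       = 1
leaves (node l r) = leaves l + leaves r

-- Partial composition t ∘_i s of Mag: graft the root of s onto the
-- i-th leaf of t (leaves numbered from 0, left to right).
graft : (t : Tree) → Fin (leaves t) → Tree → Tree
graft leaf       _ s = s
graft (node l r) i s with splitAt (leaves l) i
... | inj₁ j = node (graft l j s) r
... | inj₂ j = node l (graft r j s)

-- Combs (LComb 0 = RComb 0 = leaf is only a convenient extension;
-- LComb 1 = RComb 1 = (leaf, leaf) as in the paper).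
LComb : ℕ → Tree
LComb zero    = leaf
LComb (suc zero) = node leaf leaf
LComb (suc (suc d)) = node (LComb (suc d)) leaf

RComb : ℕ → Tree
RComb zero    = leaf
RComb (suc zero) = node leaf leaf
RComb (suc (suc d)) = node leaf (RComb (suc d))

-- ≡_γ : the smallest operad congruence on Mag with LComb γ ≡ RComb γ,
-- generated inductively: an equivalence relation containing the generator
-- and closed under partial composition of (arity-equal) related pairs.
data _⊢_≡c_ (γ : ℕ) : Tree → Tree → Set where
  gen   : γ ⊢ LComb γ ≡c RComb γ
  c-refl  : ∀ {t} → γ ⊢ t ≡c t
  c-sym   : ∀ {t u} → γ ⊢ t ≡c u → γ ⊢ u ≡c t
  c-trans : ∀ {t u v} → γ ⊢ t ≡c u → γ ⊢ u ≡c v → γ ⊢ t ≡c v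
  comp  : ∀ {t t' s s'} → γ ⊢ t ≡c t' → (e : leaves t ≡ leaves t') →
          γ ⊢ s ≡c s' → (i : Fin (leaves t)) →
          γ ⊢ graft t i s ≡c graft t' (cast e i) s'

-- An operad morphism CAs^(γ') → CAs^(γ), presented on representatives:
-- a map of trees that is well defined on classes (≡_γ' to ≡_γ),
-- arity-preserving, sends the unit to the unit and commutes with
-- partial compositions, all up to ≡_γ.
record IsOperadMorphism (γ' γ : ℕ) (f : Tree → Tree) : Set where
  field
    respects : ∀ {t u} → γ' ⊢ t ≡c u → γ ⊢ f t ≡c f u
    arity    : ∀ t → leaves (f t) ≡ leaves t
    unit     : γ ⊢ f leaf ≡c leaf
    compose  : ∀ t (i : Fin (leaves t)) s →
               γ ⊢ f (graft t i s) ≡c graft (f t) (cast (sym (arity t)) i) (f s)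

OperadMorphism : ℕ → ℕ → Set
OperadMorphism γ' γ = Σ (Tree → Tree) (IsOperadMorphism γ' γ)

-- If LComb γ' ≡_γ RComb γ', then ≡_γ' ⊆ ≡_γ and the identity of trees is a
-- morphism. Conversely, a morphism preserves arity, so it fixes the unique
-- tree with two leaves; since every tree is obtained from that one by partial
-- compositions, the morphism fixes every tree up to ≡_γ, and applying it to
-- the generator LComb γ' ≡_γ' RComb γ' gives LComb γ' ≡_γ RComb γ'.
module Submission where

open import Defs
open import Data.Nat using (ℕ; _≤_; z≤n; s≤s)
open import Data.Nat.Properties using (≤-trans; m≤m+n; +-mono-≤; suc-injective)
open import Data.Fin using (zero; suc; cast)
open import Data.Fin.Properties using (cast-is-id; cast-involutive)
open import Data.Product using (_,_)
open import Function.Bundles using (_⇔_; mk⇔)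
open import Relation.Binary.PropositionalEquality using (_≡_; refl; sym; cong; subst)

≡⇒≡c : ∀ {γ t u} → t ≡ u → γ ⊢ t ≡c u
≡⇒≡c refl = c-refl

cherry : Tree
cherry = node leaf leaf

1≤leaves : ∀ t → 1 ≤ leaves t
1≤leaves leaf       = s≤s z≤n
1≤leaves (node l r) = ≤-trans (1≤leaves l) (m≤m+n (leaves l) (leaves r))

2≤leaves-node : ∀ l r → 2 ≤ leaves (node l r)
2≤leaves-node l r = +-mono-≤ (1≤leaves l) (1≤leaves r)

leaves≡1⇒leaf : ∀ t → leaves t ≡ 1 → t ≡ leaf
leaves≡1⇒leaf leaf       _ = refl
leaves≡1⇒leaf (node l r) e with subst (2 ≤_) e (2≤leaves-node l r)
... | s≤s ()

leaves≡2⇒cherry : ∀ t → leaves t ≡ 2 → t ≡ cherry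
leaves≡2⇒cherry (node leaf r) e = cong (node leaf) (leaves≡1⇒leaf r (suc-injective e))
leaves≡2⇒cherry (node (node a b) r) e
  with subst (3 ≤_) e (+-mono-≤ (2≤leaves-node a b) (1≤leaves r))
... | s≤s (s≤s ())

⊢-mono : ∀ {γ γ'} → γ ⊢ LComb γ' ≡c RComb γ' → ∀ {t u} → γ' ⊢ t ≡c u → γ ⊢ t ≡c u
⊢-mono h gen             = h
⊢-mono h c-refl          = c-refl
⊢-mono h (c-sym p)       = c-sym (⊢-mono h p)
⊢-mono h (c-trans p q)   = c-trans (⊢-mono h p) (⊢-mono h q)
⊢-mono h (comp p e q i)  = comp (⊢-mono h p) e (⊢-mono h q) i

id-morphism : ∀ {γ γ'} → γ ⊢ LComb γ' ≡c RComb γ' → OperadMorphism γ' γ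
id-morphism h = (λ t → t) , record
  { respects = ⊢-mono h
  ; arity    = λ _ → refl
  ; unit     = c-refl
  ; compose  = λ t i s → ≡⇒≡c (cong (λ j → graft t j s) (sym (cast-is-id refl i)))
  }

module _ {γ γ' : ℕ} {f : Tree → Tree} (m : IsOperadMorphism γ' γ f) where
  open IsOperadMorphism m

  graft-fixed : ∀ {t} → γ ⊢ f t ≡c t → ∀ i s → γ ⊢ f (graft t i s) ≡c graft t i (f s)
  graft-fixed {t} ft≡t i s =
    c-trans (compose t i s)
      (c-trans (comp ft≡t (arity t) c-refl (cast (sym (arity t)) i))
               (≡⇒≡c (cong (λ j → graft t j (f s)) (cast-involutive (arity t) (sym (arity t)) i))))

  fixes-cherry : γ ⊢ f cherry ≡c cherry
  fixes-cherry = ≡⇒≡c (leaves≡2⇒cherry (f cherry) (arity cherry))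

  -- node l r = (node leaf r) ∘₀ l  and  node leaf r = cherry ∘₁ r.
  fixes : ∀ t → γ ⊢ f t ≡c t
  fixes leaf       = unit
  fixes (node l r) =
    c-trans (graft-fixed fixes-right-branch zero l)
            (comp {t = node leaf r} c-refl refl (fixes l) zero)
    where
      fixes-right-branch : γ ⊢ f (node leaf r) ≡c node leaf r
      fixes-right-branch =
        c-trans (graft-fixed fixes-cherry (suc zero) r)
                (comp {t = cherry} c-refl refl (fixes r) (suc zero))

morphism⇒combs : ∀ {γ γ'} → OperadMorphism γ' γ → γ ⊢ LComb γ' ≡c RComb γ'
morphism⇒combs (f , m) =
  c-trans (c-sym (fixes m _)) (c-trans (respects gen) (fixes m _))
  where open IsOperadMorphism m

-- Neither direction needs γ or γ' to be positive.
lemma3p2p4 : (γ γ' : ℕ) → 1 ≤ γ → 1 ≤ γ' →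
    OperadMorphism γ' γ ⇔ (γ ⊢ LComb γ' ≡c RComb γ')
lemma3p2p4 γ γ' _ _ = mk⇔ morphism⇒combs id-morphism
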